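{- Let $m\ge 3$, let $n \ge 6$ be even, let $\ell\in\mathbb{Z}_n$ have the same parity as $m$, and let $k_0 = 1, k_1,\dots,k_{m-1} \in \mathbb{Z}_n$ all be coprime to $n$. Let $\Gamma = \mathcal{X}_a(m,n,[k_0,\dots,k_{m-1}],\ell)$ and assume there exists a vertex-transitive subgroup $G \le \mathrm{Aut}(\Gamma)$ preserving the $2$-factor $\mathcal{C}$. Then there exists a nontrivial automorphism of $\Gamma$ preserving $\mathcal{C}$ and fixing $u_{0,0}$ if and only if $2\ell = 0$ in $\mathbb{Z}_n$.
   Context: $\mathcal{X}_a(m,n,[k_0,\dots,k_{m-1}],\ell)$ is the graph with vertices $u_{i,j}$ ($i\in\mathbb{Z}_m$, $j\in\mathbb{Z}_n$) and edges: $u_{i,j}u_{i,j+k_i}$ for all $i,j$ (so $u_{i,j}\sim u_{i,j\pm k_i}$); $u_{i,j}u_{i+1,j}$ for integers $0\le i\le m-2$ and $j\equiv i\pmod 2$; $u_{m-1,j}u_{0,j+\ell}$ for $j\equiv m-1\pmod 2$ (parity in $\mathbb{Z}_n$ is well defined as $n$ is even). For $i\in\mathbb{Z}_m$, $V_i=\{u_{i,j}: j\in\mathbb{Z}_n\}$, $C_i$ is the $n$-cycle induced on $V_i$, and $\mathcal{C}=\{C_i : i \in\mathbb{Z}_m\}$. An automorphism (or group) preserves $\mathcal{C}$ if it maps cycles of $\mathcal{C}$ to cycles of $\mathcal{C}$. -}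

module Defs where

open import Level using (Level) renaming (suc to lsuc; zero to lzero)
open import Data.Nat using (ℕ; zero; suc; _+_; _*_; NonZero; _%_)
open import Data.Nat.DivMod using (_mod_)
open import Data.Fin using (Fin; toℕ)
open import Data.Product using (Σ; _×_; _,_; proj₁; proj₂; ∃)
open import Data.Sum using (_⊎_)
open import Relation.Binary.PropositionalEquality using (_≡_)
open import Relation.Nullary using (¬_)
open import Function using (_∘_; id)

-- Vertex u_{i,j} is the pair (i , j) with i ∈ ℤ_m, j ∈ ℤ_n.
Vtx : ℕ → ℕ → Set
Vtx m n = Fin m × Fin n

addₙ : (n : ℕ) .{{_ : NonZero n}} → Fin n → Fin n → Fin n
addₙ n a b = (toℕ a + toℕ b) mod n

data Edge (m n : ℕ) .{{_ : NonZero n}} (k : Fin m → Fin n) (ℓ : Fin n)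
     : Vtx m n → Vtx m n → Set where
  cyc  : ∀ i j → Edge m n k ℓ (i , j) (i , addₙ n j (k i))
  rung : ∀ i i' j → toℕ i' ≡ suc (toℕ i) → toℕ j % 2 ≡ toℕ i % 2 →
         Edge m n k ℓ (i , j) (i' , j)
  wrap : ∀ i i' j → suc (toℕ i) ≡ m → toℕ i' ≡ 0 → toℕ j % 2 ≡ toℕ i % 2 →
         Edge m n k ℓ (i , j) (i' , addₙ n j ℓ)

Adj : (m n : ℕ) .{{_ : NonZero n}} (k : Fin m → Fin n) (ℓ : Fin n) →
      Vtx m n → Vtx m n → Set
Adj m n k ℓ u v = Edge m n k ℓ u v ⊎ Edge m n k ℓ v u

IsAut : (m n : ℕ) .{{_ : NonZero n}} (k : Fin m → Fin n) (ℓ : Fin n) →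
        (Vtx m n → Vtx m n) → Set
IsAut m n k ℓ f =
  Σ (Vtx m n → Vtx m n) λ g →
    (∀ v → g (f v) ≡ v) × (∀ v → f (g v) ≡ v) ×
    (∀ u v → Adj m n k ℓ u v → Adj m n k ℓ (f u) (f v)) ×
    (∀ u v → Adj m n k ℓ (f u) (f v) → Adj m n k ℓ u v)

-- f preserves 𝒞: each cycle C_i (on V_i) is mapped into (hence, f being a
-- bijection and C_i induced, onto) some cycle C_{i'} (on V_{i'}).
PreservesC : (m n : ℕ) → (Vtx m n → Vtx m n) → Set
PreservesC m n f = ∀ (i : Fin m) → ∃ λ (i' : Fin m) → ∀ (j : Fin n) → proj₁ (f (i , j)) ≡ i'

record IsVTSubgroupPreservingC (m n : ℕ) .{{_ : NonZero n}} (k : Fin m → Fin n) (ℓ : Fin n)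
       (G : (Vtx m n → Vtx m n) → Set) : Set where
  field
    auts       : ∀ f → G f → IsAut m n k ℓ f
    presC      : ∀ f → G f → PreservesC m n f
    hasId      : G id
    closedComp : ∀ f g → G f → G g → G (f ∘ g)
    closedInv  : ∀ f → G f → Σ (Vtx m n → Vtx m n) λ g →
                   G g × (∀ v → g (f v) ≡ v) × (∀ v → f (g v) ≡ v)
    transitive : ∀ u v → Σ (Vtx m n → Vtx m n) λ f → G f × f u ≡ v

HasNontrivialCStabiliser : (m n : ℕ) .{{_ : NonZero n}} (k : Fin m → Fin n) (ℓ : Fin n) → Set
HasNontrivialCStabiliser m n k ℓ =
  Σ (Vtx m n → Vtx m n) λ f →
    IsAut m n k ℓ f × PreservesC m n f ×
    (∀ (u : Vtx m n) → toℕ (proj₁ u) ≡ 0 → toℕ (proj₂ u) ≡ 0 → f u ≡ u) ×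
    (∃ λ (v : Vtx m n) → ¬ (f v ≡ v))

module Submission where

-- An automorphism f fixing u_{0,0} and preserving 𝒞 maps C_0 onto itself, where it must be
-- x ↦ ±x. The same sign propagates from V_i to V_{i+1}: a vertex of V_{i+1} of the parity of i
-- is the rung partner of a vertex of V_i, and every other vertex of V_{i+1} is the unique common
-- neighbour of two such vertices, because k_{i+1} is odd and 2k_{i+1}, 4k_{i+1} ≢ 0 (mod n).
-- Hence f is the identity or the reflection u_{i,j} ↦ u_{i,−j}, and the reflection maps the
-- wrap edges to edges exactly when 2ℓ = 0.

open import Defs
open import Data.Nat
  using (ℕ; zero; suc; _+_; _*_; _∸_; _≤_; _<_; _%_; NonZero; >-nonZero⁻¹; z≤n; s≤s)
open import Data.Nat.Properties
open import Data.Nat.DivMod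
  using (_mod_; %-distribˡ-+; m%n%n≡m%n; [m+n]%n≡m%n; [m+kn]%n≡m%n; m<n⇒m%n≡m; m%n<n; m%n≤n; n%n≡0;
         m∣n⇒o%n%m≡o%m)
open import Data.Nat.Divisibility using (_∣_; m%n≡0⇒n∣m; ∣⇒≤)
open import Data.Nat.Coprimality using (Coprime; coprime-divisor; 1-coprimeTo)
import Data.Nat.Coprimality as Coprime
open import Data.Nat.Tactic.RingSolver using (solve-∀)
open import Data.Fin using (Fin; toℕ; fromℕ; fromℕ<)
open import Data.Fin.Properties using (toℕ-injective; toℕ-fromℕ; toℕ-fromℕ<; toℕ<n)
open import Data.Product using (Σ; ∃; _×_; _,_; proj₁; proj₂)
open import Data.Sum using (_⊎_; inj₁; inj₂; swap)
open import Data.Bool using (Bool; true; false)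
open import Data.Empty using (⊥-elim)
open import Relation.Nullary using (¬_; yes; no)
open import Relation.Binary.PropositionalEquality
  using (_≡_; _≢_; ≢-sym; refl; sym; trans; cong; cong₂; subst; subst₂; module ≡-Reasoning)
open import Function using (id; _∘_)
open import Function.Bundles using (_⇔_; mk⇔)

open ≡-Reasoning

parity-cases : ∀ x → x % 2 ≡ 0 ⊎ x % 2 ≡ 1
parity-cases zero = inj₁ refl
parity-cases (suc zero) = inj₂ refl
parity-cases (suc (suc x)) = parity-cases x

suc-flips-parity : ∀ x → suc x % 2 ≢ x % 2
suc-flips-parity zero ()
suc-flips-parity (suc zero) ()
suc-flips-parity (suc (suc x)) = suc-flips-parity x

parity-≢-trans : ∀ x y z → x % 2 ≢ y % 2 → y % 2 ≢ z % 2 → x % 2 ≡ z % 2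
parity-≢-trans x y z x≢y y≢z with parity-cases x | parity-cases y | parity-cases z
... | inj₁ p | inj₁ q | _      = ⊥-elim (x≢y (trans p (sym q)))
... | inj₂ p | inj₂ q | _      = ⊥-elim (x≢y (trans p (sym q)))
... | _      | inj₁ q | inj₁ r = ⊥-elim (y≢z (trans q (sym r)))
... | _      | inj₂ q | inj₂ r = ⊥-elim (y≢z (trans q (sym r)))
... | inj₁ p | inj₂ _ | inj₁ r = trans p (sym r)
... | inj₂ p | inj₁ _ | inj₂ r = trans p (sym r)

+-parity : ∀ {a b p q} → a % 2 ≡ p → b % 2 ≡ q → (a + b) % 2 ≡ (p + q) % 2
+-parity {a} {b} a≡p b≡q = trans (%-distribˡ-+ a b 2) (cong₂ (λ x y → (x + y) % 2) a≡p b≡q)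

even-sum⇒same-parity : ∀ a b → (a + b) % 2 ≡ 0 → a % 2 ≡ b % 2
even-sum⇒same-parity a b a+b-even with parity-cases a | parity-cases b
... | inj₁ p | inj₁ q = trans p (sym q)
... | inj₂ p | inj₂ q = trans p (sym q)
... | inj₁ p | inj₂ q = ⊥-elim (0≢1+n (trans (sym a+b-even) (+-parity {a} {b} p q)))
... | inj₂ p | inj₁ q = ⊥-elim (0≢1+n (trans (sym a+b-even) (+-parity {a} {b} p q)))

+-odd-flips-parity : ∀ {c} x → c % 2 ≡ 1 → (x + c) % 2 ≢ x % 2
+-odd-flips-parity {c} x c-odd x+c≡x = suc-flips-parity x (begin
  suc x % 2              ≡⟨ cong (_% 2) (+-comm 1 x) ⟩
  (x + 1) % 2            ≡⟨ +-parity {x} {1} refl refl ⟩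
  (x % 2 + 1) % 2        ≡⟨ +-parity {x} refl c-odd ⟨
  (x + c) % 2            ≡⟨ x+c≡x ⟩
  x % 2                  ∎)

x+[1+x]%2≡1 : ∀ x → (x + suc x) % 2 ≡ 1
x+[1+x]%2≡1 x = trans (cong (_% 2) (double-plus-one x)) ([m+kn]%n≡m%n 1 x 2)
  where
  double-plus-one : ∀ x → x + suc x ≡ 1 + x * 2
  double-plus-one = solve-∀

coprime-to-even⇒odd : ∀ {x n} → 2 ∣ n → Coprime x n → x % 2 ≡ 1
coprime-to-even⇒odd {x} 2∣n coprime with parity-cases x
... | inj₂ odd  = odd
... | inj₁ even = ⊥-elim (1+n≢n {1} (coprime (m%n≡0⇒n∣m x 2 even , 2∣n)))

module Modular (n : ℕ) .{{_ : NonZero n}} where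

  infix 4 _≈_
  _≈_ : ℕ → ℕ → Set
  a ≈ b = a % n ≡ b % n

  0%n≡0 : 0 % n ≡ 0
  0%n≡0 = m<n⇒m%n≡m (>-nonZero⁻¹ n)

  +-cong : ∀ {a b c d} → a ≈ b → c ≈ d → a + c ≈ b + d
  +-cong {a} {b} {c} {d} a≈b c≈d = begin
    (a + c) % n           ≡⟨ %-distribˡ-+ a c n ⟩
    (a % n + c % n) % n   ≡⟨ cong₂ (λ x y → (x + y) % n) a≈b c≈d ⟩
    (b % n + d % n) % n   ≡⟨ %-distribˡ-+ b d n ⟨
    (b + d) % n           ∎

  %-≈ : ∀ a → a % n ≈ a
  %-≈ a = m%n%n≡m%n a n

  -- Adding n ∸ c % n undoes adding c.
  +-cancelʳ : ∀ {a b} c → a + c ≈ b + c → a ≈ b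
  +-cancelʳ {a} {b} c a+c≈b+c =
    trans (undo-shift a) (trans (+-cong a+c≈b+c refl) (sym (undo-shift b)))
    where
    r : ℕ
    r = n ∸ c % n
    undo-shift : ∀ a → a ≈ a + c + r
    undo-shift a = begin
      a % n                   ≡⟨ [m+n]%n≡m%n a n ⟨
      (a + n) % n             ≡⟨ cong (λ w → (a + w) % n) (m+[n∸m]≡n (m%n≤n c n)) ⟨
      (a + (c % n + r)) % n   ≡⟨ +-cong {a} refl (+-cong (%-≈ c) refl) ⟩
      (a + (c + r)) % n       ≡⟨ cong (_% n) (+-assoc a c r) ⟨
      (a + c + r) % n         ∎

  +-cancelˡ : ∀ {a b} c → c + a ≈ c + b → a ≈ b
  +-cancelˡ {a} {b} c c+a≈c+b =
    +-cancelʳ c (trans (cong (_% n) (+-comm a c)) (trans c+a≈c+b (cong (_% n) (+-comm c b))))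

  coprime-multiple-≉0 : ∀ {x} d .{{_ : NonZero d}} → d < n → Coprime x n → ¬ d * x ≈ 0
  coprime-multiple-≉0 {x} d d<n coprime dx≈0 =
    <⇒≱ d<n (∣⇒≤ (coprime-divisor (Coprime.sym coprime) n∣xd))
    where
    n∣xd : n ∣ x * d
    n∣xd = subst (n ∣_) (*-comm d x) (m%n≡0⇒n∣m (d * x) n (trans dx≈0 0%n≡0))

  ≈-parity : 2 ∣ n → ∀ {a b} → a ≈ b → a % 2 ≡ b % 2
  ≈-parity 2∣n {a} {b} a≈b =
    trans (sym (m∣n⇒o%n%m≡o%m 2 n a 2∣n))
          (trans (cong (_% 2) a≈b) (m∣n⇒o%n%m≡o%m 2 n b 2∣n))

  mod-≈ : ∀ t → toℕ (t mod n) ≈ t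
  mod-≈ t = trans (cong (_% n) (toℕ-fromℕ< (m%n<n t n))) (%-≈ t)

  toℕ-mod-< : ∀ {t} → t < n → toℕ (t mod n) ≡ t
  toℕ-mod-< {t} t<n = trans (toℕ-fromℕ< (m%n<n t n)) (m<n⇒m%n≡m t<n)

  toℕ-0-mod : toℕ (0 mod n) ≡ 0
  toℕ-0-mod = toℕ-mod-< (>-nonZero⁻¹ n)

  ≈⇒≡ : ∀ {x y : Fin n} → toℕ x ≈ toℕ y → x ≡ y
  ≈⇒≡ {x} {y} x≈y =
    toℕ-injective (trans (sym (m<n⇒m%n≡m (toℕ<n x))) (trans x≈y (m<n⇒m%n≡m (toℕ<n y))))

  mod-toℕ : ∀ (x : Fin n) → toℕ x mod n ≡ x
  mod-toℕ x = ≈⇒≡ (mod-≈ (toℕ x))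

  addₙ-≈ : ∀ x y → toℕ (addₙ n x y) ≈ toℕ x + toℕ y
  addₙ-≈ x y = mod-≈ (toℕ x + toℕ y)

  addₙ-cancelˡ : ∀ x {y z} → addₙ n x y ≡ addₙ n x z → y ≡ z
  addₙ-cancelˡ x {y} {z} eq =
    ≈⇒≡ (+-cancelˡ (toℕ x)
      (trans (sym (addₙ-≈ x y)) (trans (cong (λ w → toℕ w % n) eq) (addₙ-≈ x z))))

  negₙ : Fin n → Fin n
  negₙ x = (n ∸ toℕ x) mod n

  negₙ-inverse : ∀ x → toℕ (negₙ x) + toℕ x ≈ 0
  negₙ-inverse x = begin
    (toℕ (negₙ x) + toℕ x) % n   ≡⟨ +-cong (mod-≈ (n ∸ toℕ x)) refl ⟩
    (n ∸ toℕ x + toℕ x) % n      ≡⟨ cong (_% n) (m∸n+n≡m (<⇒≤ (toℕ<n x))) ⟩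
    n % n                        ≡⟨ n%n≡0 n ⟩
    0                            ≡⟨ 0%n≡0 ⟨
    0 % n                        ∎

  negₙ-unique : ∀ {x y} → toℕ x + toℕ y ≈ 0 → x ≡ negₙ y
  negₙ-unique {x} {y} x+y≈0 = ≈⇒≡ (+-cancelʳ (toℕ y) (trans x+y≈0 (sym (negₙ-inverse y))))

  negₙ-involutive : ∀ x → negₙ (negₙ x) ≡ x
  negₙ-involutive x = sym (negₙ-unique (trans (cong (_% n) (+-comm (toℕ x) _)) (negₙ-inverse x)))

  negₙ-shift : ∀ {c x y} → toℕ y ≈ toℕ x + c → toℕ (negₙ x) ≈ toℕ (negₙ y) + c
  negₙ-shift {c} {x} {y} y≈x+c = +-cancelʳ (toℕ x) (begin
    (toℕ (negₙ x) + toℕ x) % n     ≡⟨ negₙ-inverse x ⟩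
    0 % n                          ≡⟨ negₙ-inverse y ⟨
    (toℕ (negₙ y) + toℕ y) % n     ≡⟨ +-cong {toℕ (negₙ y)} refl y≈x+c ⟩
    (toℕ (negₙ y) + (toℕ x + c)) % n ≡⟨ cong (_% n) (rearrange (toℕ (negₙ y)) (toℕ x) c) ⟩
    (toℕ (negₙ y) + c + toℕ x) % n ∎)
    where
    rearrange : ∀ a b c → a + (b + c) ≡ a + c + b
    rearrange = solve-∀

  addₙ-negₙ-cancel : ∀ x y → toℕ (addₙ n x (negₙ y)) + toℕ y ≈ toℕ x
  addₙ-negₙ-cancel x y = begin
    (toℕ (addₙ n x (negₙ y)) + toℕ y) % n   ≡⟨ +-cong (addₙ-≈ x (negₙ y)) refl ⟩
    (toℕ x + toℕ (negₙ y) + toℕ y) % n      ≡⟨ cong (_% n) (+-assoc (toℕ x) _ (toℕ y)) ⟩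
    (toℕ x + (toℕ (negₙ y) + toℕ y)) % n    ≡⟨ +-cong {toℕ x} refl (negₙ-inverse y) ⟩
    (toℕ x + 0) % n                         ≡⟨ cong (_% n) (+-identityʳ (toℕ x)) ⟩
    toℕ x % n                               ∎

  negₙ-addₙ : ∀ x y → negₙ (addₙ n x y) ≡ addₙ n (negₙ x) (negₙ y)
  negₙ-addₙ x y = sym (negₙ-unique (begin
    (toℕ (addₙ n (negₙ x) (negₙ y)) + toℕ (addₙ n x y)) % n
      ≡⟨ +-cong (addₙ-≈ (negₙ x) (negₙ y)) (addₙ-≈ x y) ⟩
    (toℕ (negₙ x) + toℕ (negₙ y) + (toℕ x + toℕ y)) % n
      ≡⟨ cong (_% n) (interchange (toℕ (negₙ x)) (toℕ (negₙ y)) (toℕ x) (toℕ y)) ⟩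
    (toℕ (negₙ x) + toℕ x + (toℕ (negₙ y) + toℕ y)) % n
      ≡⟨ +-cong (negₙ-inverse x) (negₙ-inverse y) ⟩
    0 % n ∎))
    where
    interchange : ∀ a b c d → a + b + (c + d) ≡ a + c + (b + d)
    interchange = solve-∀

  negₙ-fixed⇒double≈0 : ∀ {x} → negₙ x ≡ x → 2 * toℕ x ≈ 0
  negₙ-fixed⇒double≈0 {x} eq =
    trans (cong (λ w → (toℕ x + w) % n) (+-identityʳ (toℕ x)))
          (subst (λ w → toℕ w + toℕ x ≈ 0) eq (negₙ-inverse x))

  double≈0⇒negₙ-fixed : ∀ {x} → 2 * toℕ x ≈ 0 → negₙ x ≡ x
  double≈0⇒negₙ-fixed {x} 2x≈0 =
    sym (negₙ-unique (trans (cong (λ w → (toℕ x + w) % n) (sym (+-identityʳ (toℕ x)))) 2x≈0))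

  odd-step-flips-parity : 2 ∣ n → ∀ {c x y} → c % 2 ≡ 1 → x ≈ y + c → x % 2 ≢ y % 2
  odd-step-flips-parity 2∣n {c} {x} {y} c-odd x≈y+c x≡y =
    +-odd-flips-parity y c-odd (trans (sym (≈-parity 2∣n x≈y+c)) x≡y)

  negₙ-parity : 2 ∣ n → ∀ x → toℕ (negₙ x) % 2 ≡ toℕ x % 2
  negₙ-parity 2∣n x =
    even-sum⇒same-parity (toℕ (negₙ x)) (toℕ x) (≈-parity 2∣n (negₙ-inverse x))

  signed : Bool → Fin n → Fin n
  signed true  = id
  signed false = negₙ

  signed-involutive : ∀ s x → signed s (signed s x) ≡ x
  signed-involutive true  x = refl
  signed-involutive false x = negₙ-involutive x

  signed-fixes-0 : ∀ s {x} → toℕ x ≡ 0 → signed s x ≡ x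
  signed-fixes-0 true  x≡0 = refl
  signed-fixes-0 false x≡0 = sym (negₙ-unique (cong (λ w → (w + w) % n) x≡0))

  signed-parity : 2 ∣ n → ∀ s x → toℕ (signed s x) % 2 ≡ toℕ x % 2
  signed-parity 2∣n true  x = refl
  signed-parity 2∣n false x = negₙ-parity 2∣n x

  CycleAdj : ℕ → Fin n → Fin n → Set
  CycleAdj c x y = toℕ y ≈ toℕ x + c ⊎ toℕ x ≈ toℕ y + c

  signed-CycleAdj : ∀ s {c x y} → CycleAdj c x y → CycleAdj c (signed s x) (signed s y)
  signed-CycleAdj true  adj = adj
  signed-CycleAdj false (inj₁ y≈x+c) = inj₂ (negₙ-shift y≈x+c)
  signed-CycleAdj false (inj₂ x≈y+c) = inj₁ (negₙ-shift x≈y+c)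

  signed-CycleAdjˡ : ∀ s {c x y} → CycleAdj c (signed s x) y → CycleAdj c x (signed s y)
  signed-CycleAdjˡ s {c} {x} {y} adj =
    subst (λ w → CycleAdj c w (signed s y)) (signed-involutive s x) (signed-CycleAdj s adj)

  signed-CycleAdjʳ : ∀ s {c x y} → CycleAdj c x (signed s y) → CycleAdj c (signed s x) y
  signed-CycleAdjʳ s {c} {x} {y} adj =
    subst (CycleAdj c (signed s x)) (signed-involutive s y) (signed-CycleAdj s adj)

  CycleAdj-from-0 : ∀ {c x y} → toℕ x ≡ 0 → CycleAdj c x y → ∃ λ s → toℕ (signed s y) ≈ c
  CycleAdj-from-0 {c} x≡0 (inj₁ y≈x+c) = true , trans y≈x+c (cong (λ w → (w + c) % n) x≡0)
  CycleAdj-from-0 {c} {x} {y} x≡0 (inj₂ x≈y+c) = false , +-cancelʳ (toℕ y) (begin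
    (toℕ (negₙ y) + toℕ y) % n   ≡⟨ negₙ-inverse y ⟩
    0 % n                        ≡⟨ cong (_% n) x≡0 ⟨
    toℕ x % n                    ≡⟨ x≈y+c ⟩
    (toℕ y + c) % n              ≡⟨ cong (_% n) (+-comm (toℕ y) c) ⟩
    (c + toℕ y) % n              ∎)

  CycleAdj-continue : ∀ {c a b y} → toℕ b ≈ toℕ a + c → CycleAdj c b y → y ≢ a →
                      toℕ y ≈ toℕ b + c
  CycleAdj-continue b≈a+c (inj₁ y≈b+c) y≢a = y≈b+c
  CycleAdj-continue {c} b≈a+c (inj₂ b≈y+c) y≢a =
    ⊥-elim (y≢a (≈⇒≡ (+-cancelʳ c (trans (sym b≈y+c) b≈a+c))))

  -- The other neighbour a − c of a is ruled out since d = a + 2c is neither a nor a − 2c.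
  CycleAdj-common : ∀ {c a z d} → ¬ 2 * c ≈ 0 → ¬ 4 * c ≈ 0 → toℕ d ≈ toℕ a + 2 * c →
                    CycleAdj c a z → CycleAdj c z d → toℕ z ≈ toℕ a + c
  CycleAdj-common _ _ _ (inj₁ z≈a+c) _ = z≈a+c
  CycleAdj-common {c} {a} {z} {d} 2c≉0 _ d≈a+2c (inj₂ a≈z+c) (inj₁ d≈z+c) =
    ⊥-elim (2c≉0 (+-cancelʳ (toℕ a) (begin
      (2 * c + toℕ a) % n   ≡⟨ cong (_% n) (+-comm (2 * c) (toℕ a)) ⟩
      (toℕ a + 2 * c) % n   ≡⟨ d≈a+2c ⟨
      toℕ d % n             ≡⟨ d≈z+c ⟩
      (toℕ z + c) % n       ≡⟨ a≈z+c ⟨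
      toℕ a % n             ∎)))
  CycleAdj-common {c} {a} {z} {d} _ 4c≉0 d≈a+2c (inj₂ a≈z+c) (inj₂ z≈d+c) =
    ⊥-elim (4c≉0 (+-cancelʳ (toℕ a) (begin
      (4 * c + toℕ a) % n       ≡⟨ cong (_% n) (rearrange (toℕ a) c) ⟩
      (toℕ a + 2 * c + c + c) % n ≡⟨ +-cong (+-cong d≈a+2c refl) refl ⟨
      (toℕ d + c + c) % n       ≡⟨ +-cong z≈d+c refl ⟨
      (toℕ z + c) % n           ≡⟨ a≈z+c ⟨
      toℕ a % n                 ∎)))
    where
    rearrange : ∀ a c → 4 * c + a ≡ a + 2 * c + c + c
    rearrange = solve-∀

  -- After correcting the sign at 1, the image of t + 2 is the neighbour of t + 1 other than t.
  cycle-automorphism-fixing-0 : ¬ 2 ≈ 0 →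
    (φ : Fin n → Fin n) → (∀ {x y} → φ x ≡ φ y → x ≡ y) →
    (∀ t → CycleAdj 1 (φ (t mod n)) (φ (suc t mod n))) → toℕ (φ (0 mod n)) ≡ 0 →
    ∃ λ s → ∀ x → φ x ≡ signed s x
  cycle-automorphism-fixing-0 2≉0 φ φ-injective φ-adj φ0≡0 = s , φ≡signed
    where
    sign-at-1 : ∃ λ s → toℕ (signed s (φ (1 mod n))) ≈ 1
    sign-at-1 = CycleAdj-from-0 φ0≡0 (φ-adj 0)

    s : Bool
    s = proj₁ sign-at-1

    ψ : Fin n → Fin n
    ψ = signed s ∘ φ

    ψ-injective : ∀ {x y} → ψ x ≡ ψ y → x ≡ y
    ψ-injective {x} {y} ψx≡ψy = φ-injective (begin
      φ x                 ≡⟨ signed-involutive s (φ x) ⟨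
      signed s (ψ x)      ≡⟨ cong (signed s) ψx≡ψy ⟩
      signed s (ψ y)      ≡⟨ signed-involutive s (φ y) ⟩
      φ y                 ∎)

    walk : ∀ t → toℕ (ψ (t mod n)) ≈ t × toℕ (ψ (suc t mod n)) ≈ suc t
    walk zero = cong (_% n) (trans (cong toℕ (signed-fixes-0 s φ0≡0)) φ0≡0) , proj₂ sign-at-1
    walk (suc t) = ψ[t+1]≈t+1 , (begin
      toℕ (ψ ((2 + t) mod n)) % n    ≡⟨ CycleAdj-continue ψ[t+1]≈ψ[t]+1 ψ-adj ψ[t+2]≢ψ[t] ⟩
      (toℕ (ψ (suc t mod n)) + 1) % n ≡⟨ +-cong ψ[t+1]≈t+1 refl ⟩
      (suc t + 1) % n                ≡⟨ cong (_% n) (+-comm (suc t) 1) ⟩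
      (2 + t) % n                    ∎)
      where
      ψt≈t : toℕ (ψ (t mod n)) ≈ t
      ψt≈t = proj₁ (walk t)
      ψ[t+1]≈t+1 : toℕ (ψ (suc t mod n)) ≈ suc t
      ψ[t+1]≈t+1 = proj₂ (walk t)
      ψ-adj : CycleAdj 1 (ψ (suc t mod n)) (ψ ((2 + t) mod n))
      ψ-adj = signed-CycleAdj s (φ-adj (suc t))
      ψ[t+1]≈ψ[t]+1 : toℕ (ψ (suc t mod n)) ≈ toℕ (ψ (t mod n)) + 1
      ψ[t+1]≈ψ[t]+1 = trans ψ[t+1]≈t+1 (sym (trans (+-cong ψt≈t refl) (cong (_% n) (+-comm t 1))))
      ψ[t+2]≢ψ[t] : ψ ((2 + t) mod n) ≢ ψ (t mod n)
      ψ[t+2]≢ψ[t] eq = 2≉0 (+-cancelʳ t (begin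
        (2 + t) % n                ≡⟨ mod-≈ (2 + t) ⟨
        toℕ ((2 + t) mod n) % n    ≡⟨ cong (λ x → toℕ x % n) (ψ-injective eq) ⟩
        toℕ (t mod n) % n          ≡⟨ mod-≈ t ⟩
        t % n                      ∎))

    φ≡signed : ∀ x → φ x ≡ signed s x
    φ≡signed x = begin
      φ x                         ≡⟨ signed-involutive s (φ x) ⟨
      signed s (ψ x)              ≡⟨ cong (signed s ∘ ψ) (mod-toℕ x) ⟨
      signed s (ψ (toℕ x mod n))  ≡⟨ cong (signed s) (≈⇒≡ (trans (proj₁ (walk (toℕ x)))
                                                                (sym (mod-≈ (toℕ x))))) ⟩
      signed s (toℕ x mod n)      ≡⟨ cong (signed s) (mod-toℕ x) ⟩
      signed s x                  ∎

module Graph (m′ n : ℕ) .{{_ : NonZero n}} (k : Fin (suc m′) → Fin n) (ℓ : Fin n)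
             (2≤m′ : 2 ≤ m′) (2∣n : 2 ∣ n) (ℓ-parity : toℕ ℓ % 2 ≡ suc m′ % 2) where

  open Modular n

  m : ℕ
  m = suc m′

  infix 4 _∼_
  _∼_ : Vtx m n → Vtx m n → Set
  _∼_ = Adj m n k ℓ

  m≢1 : m ≢ 1
  m≢1 m≡1 with subst (2 ≤_) (suc-injective m≡1) 2≤m′
  ... | ()

  m≢2 : m ≢ 2
  m≢2 m≡2 with subst (2 ≤_) (suc-injective m≡2) 2≤m′
  ... | s≤s ()

  cycle-edge : ∀ I {x y} → toℕ y ≈ toℕ x + toℕ (k I) → (I , x) ∼ (I , y)
  cycle-edge I {x} y≈x+k = inj₁ (subst (λ w → Edge m n k ℓ (I , x) (I , w))
                                       (≈⇒≡ (trans (addₙ-≈ x (k I)) (sym y≈x+k))) (cyc I x))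

  Edge-within-layer : ∀ {I x y} → Edge m n k ℓ (I , x) (I , y) → toℕ y ≈ toℕ x + toℕ (k I)
  Edge-within-layer (cyc i j) = addₙ-≈ j (k i)
  Edge-within-layer (rung _ _ _ i≡1+i _) = ⊥-elim (1+n≢n (sym i≡1+i))
  Edge-within-layer (wrap _ _ _ 1+i≡m i≡0 _) = ⊥-elim (m≢1 (trans (sym 1+i≡m) (cong suc i≡0)))

  ∼-within-layer : ∀ {I x y} → (I , x) ∼ (I , y) → CycleAdj (toℕ (k I)) x y
  ∼-within-layer (inj₁ e) = inj₁ (Edge-within-layer e)
  ∼-within-layer (inj₂ e) = inj₂ (Edge-within-layer e)

  -- j + ℓ ≡ (m − 1) + m (mod 2).
  wrap-target-odd : ∀ {i : Fin m} {j : Fin n} → suc (toℕ i) ≡ m → toℕ j % 2 ≡ toℕ i % 2 →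
                    toℕ (addₙ n j ℓ) % 2 ≡ 1
  wrap-target-odd {i} {j} 1+i≡m j≡i = begin
    toℕ (addₙ n j ℓ) % 2          ≡⟨ ≈-parity 2∣n (addₙ-≈ j ℓ) ⟩
    (toℕ j + toℕ ℓ) % 2
      ≡⟨ +-parity {toℕ j} j≡i (trans ℓ-parity (cong (_% 2) (sym 1+i≡m))) ⟩
    (toℕ i % 2 + suc (toℕ i) % 2) % 2 ≡⟨ +-parity {toℕ i} refl refl ⟨
    (toℕ i + suc (toℕ i)) % 2     ≡⟨ x+[1+x]%2≡1 (toℕ i) ⟩
    1                             ∎

  ∼-rung-up : ∀ {I J x y} → toℕ x % 2 ≡ toℕ I % 2 → suc (toℕ I) < m → I ≢ J →
              (I , x) ∼ (J , y) → toℕ J ≡ suc (toℕ I) × y ≡ x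
  ∼-rung-up _ _ I≢J (inj₁ (cyc _ _)) = ⊥-elim (I≢J refl)
  ∼-rung-up _ _ _ (inj₁ (rung _ _ _ J≡1+I _)) = J≡1+I , refl
  ∼-rung-up _ 1+I<m _ (inj₁ (wrap _ _ _ 1+I≡m _ _)) = ⊥-elim (<-irrefl 1+I≡m 1+I<m)
  ∼-rung-up _ _ I≢J (inj₂ (cyc _ _)) = ⊥-elim (I≢J refl)
  ∼-rung-up x≡I _ _ (inj₂ (rung J _ _ I≡1+J x≡J)) =
    ⊥-elim (suc-flips-parity (toℕ J) (trans (cong (_% 2) (sym I≡1+J)) (trans (sym x≡I) x≡J)))
  ∼-rung-up x≡I _ _ (inj₂ (wrap _ _ _ 1+J≡m I≡0 y≡J)) =
    ⊥-elim (0≢1+n (trans (trans (cong (_% 2) (sym I≡0)) (sym x≡I)) (wrap-target-odd 1+J≡m y≡J)))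

  ∼-wrap : ∀ {I J x y} → suc (toℕ I) ≡ m → toℕ J ≡ 0 → (I , x) ∼ (J , y) → y ≡ addₙ n x ℓ
  ∼-wrap 1+I≡m J≡0 (inj₁ (cyc _ _)) = ⊥-elim (m≢1 (trans (sym 1+I≡m) (cong suc J≡0)))
  ∼-wrap _ J≡0 (inj₁ (rung _ _ _ J≡1+I _)) = ⊥-elim (0≢1+n (trans (sym J≡0) J≡1+I))
  ∼-wrap _ _ (inj₁ (wrap _ _ _ _ _ _)) = refl
  ∼-wrap 1+I≡m J≡0 (inj₂ (cyc _ _)) = ⊥-elim (m≢1 (trans (sym 1+I≡m) (cong suc J≡0)))
  ∼-wrap 1+I≡m J≡0 (inj₂ (rung _ _ _ I≡1+J _)) =
    ⊥-elim (m≢2 (trans (sym 1+I≡m) (cong suc (trans I≡1+J (cong suc J≡0)))))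
  ∼-wrap 1+I≡m _ (inj₂ (wrap _ _ _ _ I≡0 _)) = ⊥-elim (m≢1 (trans (sym 1+I≡m) (cong suc I≡0)))

  twist : Bool → Vtx m n → Vtx m n
  twist s (i , j) = (i , signed s j)

  twist-involutive : ∀ s v → twist s (twist s v) ≡ v
  twist-involutive s (i , j) = cong (i ,_) (signed-involutive s j)

  reflection-Edge : 2 * toℕ ℓ ≈ 0 → ∀ {u v} → Edge m n k ℓ u v → twist false u ∼ twist false v
  reflection-Edge _ (cyc i j) =
    inj₂ (subst (λ w → Edge m n k ℓ (i , negₙ (addₙ n j (k i))) (i , w)) j′+k≡-j (cyc i _))
    where
    j′+k≡-j : addₙ n (negₙ (addₙ n j (k i))) (k i) ≡ negₙ j
    j′+k≡-j = ≈⇒≡ (trans (addₙ-≈ _ (k i)) (sym (negₙ-shift (addₙ-≈ j (k i)))))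
  reflection-Edge _ (rung i i′ j i′≡1+i j≡i) =
    inj₁ (rung i i′ (negₙ j) i′≡1+i (trans (negₙ-parity 2∣n j) j≡i))
  reflection-Edge 2ℓ≈0 (wrap i i′ j 1+i≡m i′≡0 j≡i) =
    inj₁ (subst (λ w → Edge m n k ℓ (i , negₙ j) (i′ , w)) -j+ℓ≡-[j+ℓ]
                (wrap i i′ (negₙ j) 1+i≡m i′≡0 (trans (negₙ-parity 2∣n j) j≡i)))
    where
    -j+ℓ≡-[j+ℓ] : addₙ n (negₙ j) ℓ ≡ negₙ (addₙ n j ℓ)
    -j+ℓ≡-[j+ℓ] = begin
      addₙ n (negₙ j) ℓ          ≡⟨ cong (addₙ n (negₙ j)) (double≈0⇒negₙ-fixed 2ℓ≈0) ⟨
      addₙ n (negₙ j) (negₙ ℓ)   ≡⟨ negₙ-addₙ j ℓ ⟨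
      negₙ (addₙ n j ℓ)          ∎

  reflection-adj : 2 * toℕ ℓ ≈ 0 → ∀ {u v} → u ∼ v → twist false u ∼ twist false v
  reflection-adj 2ℓ≈0 (inj₁ e) = reflection-Edge 2ℓ≈0 e
  reflection-adj 2ℓ≈0 (inj₂ e) = swap (reflection-Edge 2ℓ≈0 e)

  -- Test the reflection on the wrap edge leaving u_{m−1, m−1}.
  reflection-adj⇒2ℓ≈0 : (∀ {u v} → u ∼ v → twist false u ∼ twist false v) → 2 * toℕ ℓ ≈ 0
  reflection-adj⇒2ℓ≈0 reflection-adj = negₙ-fixed⇒double≈0 (addₙ-cancelˡ (negₙ j) (begin
    addₙ n (negₙ j) (negₙ ℓ)   ≡⟨ negₙ-addₙ j ℓ ⟨
    negₙ (addₙ n j ℓ)          ≡⟨ ∼-wrap 1+last≡m refl (reflection-adj wrap-edge) ⟩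
    addₙ n (negₙ j) ℓ          ∎))
    where
    last : Fin m
    last = fromℕ m′
    1+last≡m : suc (toℕ last) ≡ m
    1+last≡m = cong suc (toℕ-fromℕ m′)
    j : Fin n
    j = m′ mod n
    wrap-edge : (last , j) ∼ (Fin.zero , addₙ n j ℓ)
    wrap-edge = inj₁ (wrap last _ j 1+last≡m refl
                  (trans (≈-parity 2∣n (mod-≈ m′)) (cong (_% 2) (sym (toℕ-fromℕ m′)))))

  reflection-stabiliser : 2 < n → 2 * toℕ ℓ ≈ 0 → HasNontrivialCStabiliser m n k ℓ
  reflection-stabiliser 2<n 2ℓ≈0 =
    twist false , reflection-aut , (λ i → i , λ _ → refl) , fixes-u₀₀ , (Fin.zero , 1 mod n) , moves-u₀₁
    where
    reflection-aut : IsAut m n k ℓ (twist false)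
    reflection-aut = twist false , twist-involutive false , twist-involutive false ,
                     (λ _ _ → reflection-adj 2ℓ≈0) ,
                     λ u v u′∼v′ → subst₂ _∼_ (twist-involutive false u) (twist-involutive false v)
                                               (reflection-adj 2ℓ≈0 u′∼v′)

    fixes-u₀₀ : ∀ u → toℕ (proj₁ u) ≡ 0 → toℕ (proj₂ u) ≡ 0 → twist false u ≡ u
    fixes-u₀₀ (i , j) _ j≡0 = cong (i ,_) (signed-fixes-0 false j≡0)

    moves-u₀₁ : twist false (Fin.zero , 1 mod n) ≢ (Fin.zero , 1 mod n)
    moves-u₀₁ eq = coprime-multiple-≉0 2 2<n (1-coprimeTo n)
      (subst (λ x → 2 * x ≈ 0) (toℕ-mod-< (<-trans (s≤s (s≤s z≤n)) 2<n))
                                (negₙ-fixed⇒double≈0 (cong proj₂ eq)))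

  module Rigidity (k₀≡1 : toℕ (k Fin.zero) ≡ 1) (k-coprime : ∀ i → Coprime (toℕ (k i)) n)
                  (4<n : 4 < n)
                  (f : Vtx m n → Vtx m n) (f-injective : ∀ {u v} → f u ≡ f v → u ≡ v)
                  (f-adj : ∀ {u v} → u ∼ v → f u ∼ f v) (f-preserves-C : PreservesC m n f)
                  (f-fix : f (Fin.zero , 0 mod n) ≡ (Fin.zero , 0 mod n)) where

    2<n : 2 < n
    2<n = <-trans (s≤s (s≤s (s≤s z≤n))) 4<n

    layer-constant : ∀ I j j′ → proj₁ (f (I , j)) ≡ proj₁ (f (I , j′))
    layer-constant I j j′ = trans (proj₂ (f-preserves-C I) j) (sym (proj₂ (f-preserves-C I) j′))

    image-adj : ∀ {u v J a b} → u ∼ v → f u ≡ (J , a) → f v ≡ (J , b) → CycleAdj (toℕ (k J)) a b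
    image-adj adj fu≡ fv≡ = ∼-within-layer (subst₂ _∼_ fu≡ fv≡ (f-adj adj))

    Twisted : Bool → Fin m → Set
    Twisted s I = ∀ j → f (I , j) ≡ (I , signed s j)

    first-layer : ∃ λ s → Twisted s Fin.zero
    first-layer = proj₁ φ≡±id , λ j → trans (in-layer-0 j) (cong (Fin.zero ,_) (proj₂ φ≡±id j))
      where
      φ : Fin n → Fin n
      φ j = proj₂ (f (Fin.zero , j))
      in-layer-0 : ∀ j → f (Fin.zero , j) ≡ (Fin.zero , φ j)
      in-layer-0 j = cong (_, φ j) (trans (layer-constant Fin.zero j (0 mod n)) (cong proj₁ f-fix))
      φ-injective : ∀ {x y} → φ x ≡ φ y → x ≡ y
      φ-injective {x} {y} φx≡φy =
        cong proj₂ (f-injective (trans (in-layer-0 x)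
                                       (trans (cong (Fin.zero ,_) φx≡φy) (sym (in-layer-0 y)))))
      φ-adj : ∀ t → CycleAdj 1 (φ (t mod n)) (φ (suc t mod n))
      φ-adj t = subst (λ c → CycleAdj c _ _) k₀≡1
                      (image-adj (cycle-edge Fin.zero t+1≈t+k₀) (in-layer-0 _) (in-layer-0 _))
        where
        t+1≈t+k₀ : toℕ (suc t mod n) ≈ toℕ (t mod n) + toℕ (k Fin.zero)
        t+1≈t+k₀ = trans (mod-≈ (suc t))
          (sym (trans (+-cong (mod-≈ t) (cong (_% n) k₀≡1)) (cong (_% n) (+-comm t 1))))
      φ0≡0 : toℕ (φ (0 mod n)) ≡ 0
      φ0≡0 = trans (cong (toℕ ∘ proj₂) f-fix) toℕ-0-mod
      φ≡±id : ∃ λ s → ∀ j → φ j ≡ signed s j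
      φ≡±id = cycle-automorphism-fixing-0 (coprime-multiple-≉0 2 2<n (1-coprimeTo n))
                                          φ φ-injective φ-adj φ0≡0

    rung-vertex : ∀ s {I I′} → toℕ I′ ≡ suc (toℕ I) → Twisted s I →
                  ∀ j → toℕ j % 2 ≡ toℕ I % 2 → f (I′ , j) ≡ (I′ , signed s j)
    rung-vertex s {I} {I′} I′≡1+I twisted j j≡I =
      cong₂ _,_ (toℕ-injective (trans (proj₁ up) (sym I′≡1+I))) (proj₂ up)
      where
      adj : (I , signed s j) ∼ f (I′ , j)
      adj = subst (_∼ f (I′ , j)) (twisted j) (f-adj (inj₁ (rung I I′ j I′≡1+I j≡I)))
      y : Fin n
      y = proj₂ (f (I′ , j))
      leaves-layer : I ≢ proj₁ (f (I′ , j))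
      leaves-layer I≡J = 1+n≢n (trans (sym I′≡1+I) (cong (toℕ ∘ proj₁) (f-injective (begin
        f (I′ , j)                    ≡⟨ cong (_, y) I≡J ⟨
        (I , y)                       ≡⟨ cong (I ,_) (signed-involutive s y) ⟨
        (I , signed s (signed s y))   ≡⟨ twisted (signed s y) ⟨
        f (I , signed s y)            ∎))))
      up : toℕ (proj₁ (f (I′ , j))) ≡ suc (toℕ I) × proj₂ (f (I′ , j)) ≡ signed s j
      up = ∼-rung-up (trans (signed-parity 2∣n s j) j≡I) (subst (_< m) I′≡1+I (toℕ<n I′))
                     leaves-layer adj

    -- j ∓ k_{I′} are rung vertices since k_{I′} is odd.
    off-rung-vertex : ∀ s {I I′ : Fin m} →
                      (∀ j → toℕ j % 2 ≡ toℕ I % 2 → f (I′ , j) ≡ (I′ , signed s j)) →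
                      ∀ j → toℕ j % 2 ≢ toℕ I % 2 → f (I′ , j) ≡ (I′ , signed s j)
    off-rung-vertex s {I} {I′} on-rung j j≢I = trans in-layer (cong (I′ ,_) y≡±j)
      where
      κ : ℕ
      κ = toℕ (k I′)
      κ-odd : κ % 2 ≡ 1
      κ-odd = coprime-to-even⇒odd 2∣n (k-coprime I′)
      a c : Fin n
      a = addₙ n j (negₙ (k I′))
      c = addₙ n j (k I′)
      a+κ≈j : toℕ a + κ ≈ toℕ j
      a+κ≈j = addₙ-negₙ-cancel j (k I′)
      c≈j+κ : toℕ c ≈ toℕ j + κ
      c≈j+κ = addₙ-≈ j (k I′)
      c≈a+2κ : toℕ c ≈ toℕ a + 2 * κ
      c≈a+2κ = trans c≈j+κ (trans (+-cong (sym a+κ≈j) refl) (cong (_% n) (double-step (toℕ a) κ)))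
        where
        double-step : ∀ a c → a + c + c ≡ a + 2 * c
        double-step = solve-∀
      a≡I : toℕ a % 2 ≡ toℕ I % 2
      a≡I = parity-≢-trans (toℕ a) (toℕ j) (toℕ I)
              (≢-sym (odd-step-flips-parity 2∣n {κ} κ-odd (sym a+κ≈j))) j≢I
      c≡I : toℕ c % 2 ≡ toℕ I % 2
      c≡I = parity-≢-trans (toℕ c) (toℕ j) (toℕ I)
              (odd-step-flips-parity 2∣n {κ} κ-odd c≈j+κ) j≢I
      y : Fin n
      y = proj₂ (f (I′ , j))
      in-layer : f (I′ , j) ≡ (I′ , y)
      in-layer = cong (_, y) (trans (layer-constant I′ j a) (cong proj₁ (on-rung a a≡I)))
      from-a : CycleAdj κ (signed s a) y
      from-a = image-adj (cycle-edge I′ (sym a+κ≈j)) (on-rung a a≡I) in-layer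
      to-c : CycleAdj κ y (signed s c)
      to-c = image-adj (cycle-edge I′ c≈j+κ) in-layer (on-rung c c≡I)
      ±y≈j : toℕ (signed s y) ≈ toℕ j
      ±y≈j = trans (CycleAdj-common (coprime-multiple-≉0 2 2<n (k-coprime I′))
                                    (coprime-multiple-≉0 4 4<n (k-coprime I′))
                                    c≈a+2κ (signed-CycleAdjˡ s from-a) (signed-CycleAdjʳ s to-c))
                   a+κ≈j
      y≡±j : y ≡ signed s j
      y≡±j = trans (sym (signed-involutive s y)) (cong (signed s) (≈⇒≡ ±y≈j))

    next-layer : ∀ s {I I′} → toℕ I′ ≡ suc (toℕ I) → Twisted s I → Twisted s I′
    next-layer s {I} I′≡1+I twisted j with toℕ j % 2 ≟ toℕ I % 2
    ... | yes j≡I = rung-vertex s I′≡1+I twisted j j≡I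
    ... | no  j≢I = off-rung-vertex s {I} (rung-vertex s I′≡1+I twisted) j j≢I

    all-layers : ∀ s → Twisted s Fin.zero → ∀ I → Twisted s I
    all-layers s twisted₀ I = layer (toℕ I) I refl
      where
      layer : ∀ i (I : Fin m) → toℕ I ≡ i → Twisted s I
      layer zero I I≡0 = subst (Twisted s) (sym (toℕ-injective {i = I} {j = Fin.zero} I≡0)) twisted₀
      layer (suc i) I′ I′≡1+i = next-layer s I′≡1+J (layer i J (toℕ-fromℕ< i<m))
        where
        i<m : i < m
        i<m = <⇒≤ (subst (_< m) I′≡1+i (toℕ<n I′))
        J : Fin m
        J = fromℕ< i<m
        I′≡1+J : toℕ I′ ≡ suc (toℕ J)
        I′≡1+J = trans I′≡1+i (cong suc (sym (toℕ-fromℕ< i<m)))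

    f-is-twist : ∃ λ s → ∀ v → f v ≡ twist s v
    f-is-twist = s , λ (I , j) → all-layers s twisted₀ I j
      where
      s : Bool
      s = proj₁ first-layer
      twisted₀ : Twisted s Fin.zero
      twisted₀ = proj₂ first-layer

    moving⇒2ℓ≈0 : (∃ λ v → f v ≢ v) → 2 * toℕ ℓ ≈ 0
    moving⇒2ℓ≈0 (v , f-moves-v) = by-sign (proj₁ f-is-twist) (proj₂ f-is-twist)
      where
      by-sign : ∀ s → (∀ v → f v ≡ twist s v) → 2 * toℕ ℓ ≈ 0
      by-sign true  f≡id = ⊥-elim (f-moves-v (f≡id v))
      by-sign false f≡reflection = reflection-adj⇒2ℓ≈0 λ {u} {w} u∼w →
        subst₂ _∼_ (f≡reflection u) (f≡reflection w) (f-adj u∼w)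

lemma5p4 : (m n : ℕ) .{{_ : NonZero n}} → 3 ≤ m → 6 ≤ n → n % 2 ≡ 0 →
           (ℓ : Fin n) → toℕ ℓ % 2 ≡ m % 2 →
           (k : Fin m → Fin n) →
           (∀ (i : Fin m) → toℕ i ≡ 0 → toℕ (k i) ≡ 1) →
           (∀ (i : Fin m) → Coprime (toℕ (k i)) n) →
           Σ ((Vtx m n → Vtx m n) → Set) (IsVTSubgroupPreservingC m n k ℓ) →
           (HasNontrivialCStabiliser m n k ℓ ⇔ ((2 * toℕ ℓ) % n ≡ 0))
lemma5p4 zero n ()
lemma5p4 (suc m′) n (s≤s 2≤m′) 6≤n n-even ℓ ℓ-parity k k₀≡1 k-coprime _ =
  mk⇔ forward (λ 2ℓ≡0 → reflection-stabiliser 2<n (trans 2ℓ≡0 (sym 0%n≡0)))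
  where
  open Modular n
  open Graph m′ n k ℓ 2≤m′ (m%n≡0⇒n∣m n 2 n-even) ℓ-parity

  2<n : 2 < n
  2<n = ≤-trans (s≤s (s≤s (s≤s z≤n))) 6≤n

  forward : HasNontrivialCStabiliser (suc m′) n k ℓ → (2 * toℕ ℓ) % n ≡ 0
  forward (f , (g , g∘f≡id , _ , f-adj , _) , f-preserves-C , f-fix , f-moves) =
    trans (Rigidity.moving⇒2ℓ≈0 (k₀≡1 Fin.zero refl) k-coprime (<⇒≤ 6≤n)
                                f f-injective (λ {u} {v} → f-adj u v) f-preserves-C
                                (f-fix _ refl toℕ-0-mod) f-moves)
          0%n≡0
    where
    f-injective : ∀ {u v} → f u ≡ f v → u ≡ v
    f-injective {u} {v} fu≡fv = trans (sym (g∘f≡id u)) (trans (cong g fu≡fv) (g∘f≡id v))
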